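{- Let $\mathbf A=(A,\wedge,\vee,\to,t,f)$ be a bRS-algebra and let $A^{\bowtie}=\{\langle a,b\rangle\in A^2: a\vee b=t,\ a\wedge b\le f\}$ and $\Sigma(\mathbf A)=\{\langle a,b\rangle\in A^2: a\vee b=t,\ f\to b=b\}$, both regarded as lattices under $\langle a,b\rangle\wedge\langle c,d\rangle=\langle a\wedge c,b\vee d\rangle$ and $\langle a,b\rangle\vee\langle c,d\rangle=\langle a\vee c,b\wedge d\rangle$. Then the map $\delta_{\mathbf A}\colon A^{\bowtie}\to\Sigma(\mathbf A)$, $\delta_{\mathbf A}\langle a,b\rangle=\langle a,f\to b\rangle$, is a lattice isomorphism, with inverse $\delta_{\mathbf A}^{ -1}\langle a,b\rangle=\langle a,b\wedge(a\to f)\rangle$.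
   Context: A Brouwerian algebra is $(A,\wedge,\vee,\to,t)$ with $(A,\wedge,\vee)$ a lattice with top $t$ and $a\wedge b\le c\iff a\le b\to c$. A relative Stone algebra is a Brouwerian algebra satisfying $(a\to b)\vee(b\to a)=t$. A bRS-algebra is a relative Stone algebra with an element $f$ satisfying $a\vee(a\to f)=t$ for all $a$. (The sets $A^{\bowtie}$ and $\Sigma(\mathbf A)$ are closed under the stated operations, and $\delta_{\mathbf A}$ maps $A^{\bowtie}$ into $\Sigma(\mathbf A)$.) -}

module Defs where

open import Level using (Level; _⊔_) renaming (suc to lsuc)
open import Data.Product using (_×_; _,_; proj₁; proj₂)
open import Relation.Binary.Core using (Rel)
open import Algebra.Core using (Op₂)
open import Algebra.Lattice.Bundles using (Lattice)

record BrouwerianAlgebra (c ℓ : Level) : Set (lsuc (c ⊔ ℓ)) where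
  field
    lattice : Lattice c ℓ
  open Lattice lattice public
  infixr 5 _⇒_
  infix 4 _≤_
  _≤_ : Rel Carrier ℓ
  a ≤ b = (a ∧ b) ≈ a
  field
    _⇒_      : Op₂ Carrier
    ⇒-cong   : ∀ {a a' b b'} → a ≈ a' → b ≈ b' → (a ⇒ b) ≈ (a' ⇒ b')
    t        : Carrier
    ≤-t      : ∀ a → a ≤ t
    residuˡ  : ∀ a b c → (a ∧ b) ≤ c → a ≤ (b ⇒ c)
    residuʳ  : ∀ a b c → a ≤ (b ⇒ c) → (a ∧ b) ≤ c

record RelativeStoneAlgebra (c ℓ : Level) : Set (lsuc (c ⊔ ℓ)) where
  field
    brouwerian : BrouwerianAlgebra c ℓ
  open BrouwerianAlgebra brouwerian public
  field
    prelinear : ∀ a b → ((a ⇒ b) ∨ (b ⇒ a)) ≈ t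

record BRSAlgebra (c ℓ : Level) : Set (lsuc (c ⊔ ℓ)) where
  field
    relStone : RelativeStoneAlgebra c ℓ
  open RelativeStoneAlgebra relStone public
  field
    f     : Carrier
    f-law : ∀ a → (a ∨ (a ⇒ f)) ≈ t

module _ {c ℓ : Level} (A : BRSAlgebra c ℓ) where
  open BRSAlgebra A

  InBowtie : Carrier × Carrier → Set ℓ
  InBowtie (a , b) = ((a ∨ b) ≈ t) × ((a ∧ b) ≤ f)

  InSigma : Carrier × Carrier → Set ℓ
  InSigma (a , b) = ((a ∨ b) ≈ t) × ((f ⇒ b) ≈ b)

  _⊓_ : Op₂ (Carrier × Carrier)
  (a , b) ⊓ (c' , d) = (a ∧ c') , (b ∨ d)

  _⊔ₚ_ : Op₂ (Carrier × Carrier)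
  (a , b) ⊔ₚ (c' , d) = (a ∨ c') , (b ∧ d)

  _≈ₚ_ : Rel (Carrier × Carrier) ℓ
  (a , b) ≈ₚ (c' , d) = (a ≈ c') × (b ≈ d)

  δ : Carrier × Carrier → Carrier × Carrier
  δ (a , b) = a , (f ⇒ b)

  δ⁻¹ : Carrier × Carrier → Carrier × Carrier
  δ⁻¹ (a , b) = a , (b ∧ (a ⇒ f))

  record IsLatticeIsoWithInverse : Set (c ⊔ ℓ) where
    field
      δ-into     : ∀ x → InBowtie x → InSigma (δ x)
      δ-cong     : ∀ x y → InBowtie x → InBowtie y → x ≈ₚ y → δ x ≈ₚ δ y
      δ-∧        : ∀ x y → InBowtie x → InBowtie y → δ (x ⊓ y) ≈ₚ (δ x ⊓ δ y)
      δ-∨        : ∀ x y → InBowtie x → InBowtie y → δ (x ⊔ₚ y) ≈ₚ (δ x ⊔ₚ δ y)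
      δ⁻¹-into   : ∀ x → InSigma x → InBowtie (δ⁻¹ x)
      δ⁻¹-cong   : ∀ x y → InSigma x → InSigma y → x ≈ₚ y → δ⁻¹ x ≈ₚ δ⁻¹ y
      δ⁻¹∘δ      : ∀ x → InBowtie x → δ⁻¹ (δ x) ≈ₚ x
      δ∘δ⁻¹      : ∀ x → InSigma x → δ (δ⁻¹ x) ≈ₚ x

module Submission where

-- * Brouwerian algebras: residuation makes the lattice distributive
--   (so both distributive laws hold), and  x ⇒ _  preserves meets,
--   satisfies  f ⇒ (f ⇒ b) = f ⇒ b  and  x ⇒ y = t  whenever x ≤ y.
-- * Relative Stone algebras: prelinearity  (y ⇒ z) ∨ (z ⇒ y) = t  makes
--   x ⇒ _  preserve joins as well.
-- * bRS-algebras: with these identities, δ⟨a,b⟩ = ⟨a, f ⇒ b⟩ and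
--   δ⁻¹⟨a,b⟩ = ⟨a, b ∧ (a ⇒ f)⟩ map A^⋈ and Σ(A) into each other,
--   commute with ⊓ and ⊔ (because f ⇒ _ preserves ∨ and ∧), and are
--   mutually inverse: for ⟨a,b⟩ ∈ A^⋈ one gets (f ⇒ b) ∧ (a ⇒ f) = b by
--   splitting along a ∨ b = t, and for ⟨a,b⟩ ∈ Σ(A) one gets
--   f ⇒ (b ∧ (a ⇒ f)) = (f ⇒ b) ∧ t = b.

open import Level using (Level)
open import Data.Product using (_,_)
open import Defs
import Algebra.Lattice.Properties.Lattice as AlgebraicLatticeProperties
import Relation.Binary.Lattice as OrderLattice
import Relation.Binary.Lattice.Properties.MeetSemilattice as MeetProperties
import Relation.Binary.Lattice.Properties.JoinSemilattice as JoinProperties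
import Relation.Binary.Lattice.Properties.DistributiveLattice as DistributiveProperties
import Relation.Binary.Reasoning.PartialOrder as PartialOrderReasoning

module BrouwerianProperties {c ℓ : Level} (B : BrouwerianAlgebra c ℓ) where
  open BrouwerianAlgebra B

  -- The lattice viewed order-theoretically, with  x ⊑ y  meaning  x ≈ x ∧ y;
  -- this is the record's order  x ≤ y  read backwards.
  orderLattice : OrderLattice.Lattice c ℓ ℓ
  orderLattice = AlgebraicLatticeProperties.∨-∧-orderTheoreticLattice lattice

  open OrderLattice.Lattice orderLattice public
    using (poset; x≤x∨y; y≤x∨y; ∨-least; x∧y≤x; x∧y≤y; ∧-greatest)
    renaming (_≤_ to _⊑_; refl to ⊑-refl; trans to ⊑-trans; antisym to ⊑-antisym; reflexive to ⊑-reflexive)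
  open MeetProperties (OrderLattice.Lattice.meetSemilattice orderLattice) public using (∧-monotonic)
  open JoinProperties (OrderLattice.Lattice.joinSemilattice orderLattice) public using (∨-monotonic)

  ≤⇒⊑ : ∀ {a b} → a ≤ b → a ⊑ b
  ≤⇒⊑ = sym

  ⊑⇒≤ : ∀ {a b} → a ⊑ b → a ≤ b
  ⊑⇒≤ = sym

  curry : ∀ {a b d} → (a ∧ b) ⊑ d → a ⊑ (b ⇒ d)
  curry p = ≤⇒⊑ (residuˡ _ _ _ (⊑⇒≤ p))

  uncurry : ∀ {a b d} → a ⊑ (b ⇒ d) → (a ∧ b) ⊑ d
  uncurry p = ≤⇒⊑ (residuʳ _ _ _ (⊑⇒≤ p))

  modusPonens : ∀ a b → ((a ⇒ b) ∧ a) ⊑ b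
  modusPonens a b = uncurry ⊑-refl

  ⊑-t : ∀ a → a ⊑ t
  ⊑-t a = ≤⇒⊑ (≤-t a)

  t⊑⇒≈t : ∀ {a} → t ⊑ a → a ≈ t
  t⊑⇒≈t = ⊑-antisym (⊑-t _)

  -- Meets distribute over joins: a ∧ _ is a left adjoint (to a ⇒ _).
  ∧-distribˡ-∨ : ∀ a b d → (a ∧ (b ∨ d)) ≈ ((a ∧ b) ∨ (a ∧ d))
  ∧-distribˡ-∨ a b d = ⊑-antisym
    (⊑-trans (⊑-reflexive (∧-comm a (b ∨ d))) (uncurry (∨-least
      (curry (⊑-trans (⊑-reflexive (∧-comm b a)) (x≤x∨y _ _)))
      (curry (⊑-trans (⊑-reflexive (∧-comm d a)) (y≤x∨y _ _))))))
    (∨-least (∧-monotonic ⊑-refl (x≤x∨y b d)) (∧-monotonic ⊑-refl (y≤x∨y b d)))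

  distributiveLattice : OrderLattice.DistributiveLattice c ℓ ℓ
  distributiveLattice = record
    { isDistributiveLattice = record
      { isLattice = OrderLattice.Lattice.isLattice orderLattice
      ; ∧-distribˡ-∨ = ∧-distribˡ-∨
      }
    }

  open DistributiveProperties distributiveLattice public using (∨-distribˡ-∧)

  y⊑x⇒y : ∀ x y → y ⊑ (x ⇒ y)
  y⊑x⇒y x y = curry (x∧y≤x y x)

  ⇒-monoʳ : ∀ {x y z} → y ⊑ z → (x ⇒ y) ⊑ (x ⇒ z)
  ⇒-monoʳ {x} p = curry (⊑-trans (modusPonens x _) p)

  ⊑⇒⇒≈t : ∀ {x y} → x ⊑ y → (x ⇒ y) ≈ t
  ⊑⇒⇒≈t p = t⊑⇒≈t (curry (⊑-trans (x∧y≤y _ _) p))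

  ⇒-distrib-∧ : ∀ x y z → (x ⇒ (y ∧ z)) ≈ ((x ⇒ y) ∧ (x ⇒ z))
  ⇒-distrib-∧ x y z = ⊑-antisym
    (∧-greatest (⇒-monoʳ (x∧y≤x y z)) (⇒-monoʳ (x∧y≤y y z)))
    (curry (∧-greatest
      (⊑-trans (∧-monotonic (x∧y≤x _ _) ⊑-refl) (modusPonens x y))
      (⊑-trans (∧-monotonic (x∧y≤y _ _) ⊑-refl) (modusPonens x z))))

  ⇒-contract : ∀ x y → (x ⇒ (x ⇒ y)) ≈ (x ⇒ y)
  ⇒-contract x y = ⊑-antisym
    (curry (⊑-trans (∧-greatest (modusPonens x (x ⇒ y)) (x∧y≤y _ x)) (modusPonens x y)))
    (y⊑x⇒y x (x ⇒ y))

  ⇒-trans : ∀ x y z → ((x ⇒ y) ∧ (y ⇒ z)) ⊑ (x ⇒ z)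
  ⇒-trans x y z = curry (begin
    ((x ⇒ y) ∧ (y ⇒ z)) ∧ x    ≈⟨ ∧-assoc _ _ _ ⟩
    (x ⇒ y) ∧ ((y ⇒ z) ∧ x)    ≈⟨ ∧-cong refl (∧-comm _ _) ⟩
    (x ⇒ y) ∧ (x ∧ (y ⇒ z))    ≈⟨ sym (∧-assoc _ _ _) ⟩
    ((x ⇒ y) ∧ x) ∧ (y ⇒ z)    ≤⟨ ∧-monotonic (modusPonens x y) ⊑-refl ⟩
    y ∧ (y ⇒ z)                ≈⟨ ∧-comm _ _ ⟩
    (y ⇒ z) ∧ y                ≤⟨ modusPonens y z ⟩
    z                          ∎)
    where open PartialOrderReasoning poset

  ⇒-weaken-∨ : ∀ y z → (y ⇒ z) ⊑ ((y ∨ z) ⇒ z)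
  ⇒-weaken-∨ y z = curry (begin
    (y ⇒ z) ∧ (y ∨ z)                ≈⟨ ∧-distribˡ-∨ _ y z ⟩
    ((y ⇒ z) ∧ y) ∨ ((y ⇒ z) ∧ z)    ≤⟨ ∨-least (modusPonens y z) (x∧y≤y _ z) ⟩
    z                                ∎)
    where open PartialOrderReasoning poset

module RelativeStoneProperties {c ℓ : Level} (R : RelativeStoneAlgebra c ℓ) where
  open RelativeStoneAlgebra R
  open BrouwerianProperties brouwerian

  ⇒-∨-elim : ∀ x y z → ((x ⇒ (y ∨ z)) ∧ (y ⇒ z)) ⊑ (x ⇒ z)
  ⇒-∨-elim x y z =
    ⊑-trans (∧-monotonic ⊑-refl (⇒-weaken-∨ y z)) (⇒-trans x (y ∨ z) z)

  -- By prelinearity x ⇒ _ also preserves joins: split x ⇒ (y ∨ z)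
  -- along the cover (y ⇒ z) ∨ (z ⇒ y) = t.
  ⇒-distrib-∨ : ∀ x y z → (x ⇒ (y ∨ z)) ≈ ((x ⇒ y) ∨ (x ⇒ z))
  ⇒-distrib-∨ x y z = ⊑-antisym
    (begin
      u                                  ≈⟨ sym (≤-t u) ⟩
      u ∧ t                              ≈⟨ ∧-cong refl (sym (prelinear y z)) ⟩
      u ∧ ((y ⇒ z) ∨ (z ⇒ y))            ≈⟨ ∧-distribˡ-∨ u _ _ ⟩
      (u ∧ (y ⇒ z)) ∨ (u ∧ (z ⇒ y))      ≤⟨ ∨-monotonic (⇒-∨-elim x y z) u∧[z⇒y]⊑x⇒y ⟩
      (x ⇒ z) ∨ (x ⇒ y)                  ≈⟨ ∨-comm _ _ ⟩
      (x ⇒ y) ∨ (x ⇒ z)                  ∎)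
    (∨-least (⇒-monoʳ (x≤x∨y y z)) (⇒-monoʳ (y≤x∨y y z)))
    where
    open PartialOrderReasoning poset
    u = x ⇒ (y ∨ z)
    u∧[z⇒y]⊑x⇒y : (u ∧ (z ⇒ y)) ⊑ (x ⇒ y)
    u∧[z⇒y]⊑x⇒y = ⊑-trans
      (∧-monotonic (⊑-reflexive (⇒-cong refl (∨-comm y z))) ⊑-refl)
      (⇒-∨-elim x z y)

module BRSProperties {c ℓ : Level} (A : BRSAlgebra c ℓ) where
  open BRSAlgebra A
  open BrouwerianProperties brouwerian
  open RelativeStoneProperties relStone using (⇒-distrib-∨)

  -- t = a ∨ b ⊑ a ∨ (f ⇒ b), and f ⇒ (f ⇒ b) = f ⇒ b.
  δ-into : ∀ x → InBowtie A x → InSigma A (δ A x)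
  δ-into (a , b) (a∨b≈t , _) =
    t⊑⇒≈t (⊑-trans (⊑-reflexive (sym a∨b≈t)) (∨-monotonic ⊑-refl (y⊑x⇒y f b)))
    , ⇒-contract f b

  δ⁻¹-into : ∀ x → InSigma A x → InBowtie A (δ⁻¹ A x)
  δ⁻¹-into (a , b) (a∨b≈t , _) = join≈t , ⊑⇒≤ meet⊑f
    where
    open PartialOrderReasoning poset
    join≈t : (a ∨ (b ∧ (a ⇒ f))) ≈ t
    join≈t = begin-equality
      a ∨ (b ∧ (a ⇒ f))          ≈⟨ ∨-distribˡ-∧ a b (a ⇒ f) ⟩
      (a ∨ b) ∧ (a ∨ (a ⇒ f))    ≈⟨ ∧-cong a∨b≈t (f-law a) ⟩
      t ∧ t                      ≈⟨ ≤-t t ⟩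
      t                          ∎
    meet⊑f : (a ∧ (b ∧ (a ⇒ f))) ⊑ f
    meet⊑f = begin
      a ∧ (b ∧ (a ⇒ f))    ≤⟨ ∧-monotonic ⊑-refl (x∧y≤y b _) ⟩
      a ∧ (a ⇒ f)          ≈⟨ ∧-comm _ _ ⟩
      (a ⇒ f) ∧ a          ≤⟨ modusPonens a f ⟩
      f                    ∎

  -- On A^⋈, (f ⇒ b) ∧ (a ⇒ f) = b: split along a ∨ b = t for ⊑; for ⊒ use
  -- b ⊑ f ⇒ b and b ∧ a ⊑ f.
  δ⁻¹∘δ : ∀ x → InBowtie A x → _≈ₚ_ A (δ⁻¹ A (δ A x)) x
  δ⁻¹∘δ (a , b) (a∨b≈t , a∧b≤f) = refl , ⊑-antisym
    (begin
      v                      ≈⟨ sym (≤-t v) ⟩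
      v ∧ t                  ≈⟨ ∧-cong refl (sym a∨b≈t) ⟩
      v ∧ (a ∨ b)            ≈⟨ ∧-distribˡ-∨ v a b ⟩
      (v ∧ a) ∨ (v ∧ b)      ≤⟨ ∨-least v∧a⊑b (x∧y≤y v b) ⟩
      b                      ∎)
    (∧-greatest (y⊑x⇒y f b) (curry (⊑-trans (⊑-reflexive (∧-comm b a)) (≤⇒⊑ a∧b≤f))))
    where
    open PartialOrderReasoning poset
    v = (f ⇒ b) ∧ (a ⇒ f)
    v∧a⊑b : (v ∧ a) ⊑ b
    v∧a⊑b = begin
      ((f ⇒ b) ∧ (a ⇒ f)) ∧ a    ≈⟨ ∧-assoc _ _ _ ⟩
      (f ⇒ b) ∧ ((a ⇒ f) ∧ a)    ≤⟨ ∧-monotonic ⊑-refl (modusPonens a f) ⟩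
      (f ⇒ b) ∧ f                ≤⟨ modusPonens f b ⟩
      b                          ∎

  -- On Σ(A), f ⇒ (b ∧ (a ⇒ f)) = (f ⇒ b) ∧ t = b, since f ⊑ a ⇒ f.
  δ∘δ⁻¹ : ∀ x → InSigma A x → _≈ₚ_ A (δ A (δ⁻¹ A x)) x
  δ∘δ⁻¹ (a , b) (_ , f⇒b≈b) = refl , (begin-equality
    f ⇒ (b ∧ (a ⇒ f))          ≈⟨ ⇒-distrib-∧ f b (a ⇒ f) ⟩
    (f ⇒ b) ∧ (f ⇒ (a ⇒ f))    ≈⟨ ∧-cong f⇒b≈b (⊑⇒⇒≈t (y⊑x⇒y a f)) ⟩
    b ∧ t                      ≈⟨ ≤-t b ⟩
    b                          ∎)
    where open PartialOrderReasoning poset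

  δ-cong : ∀ x y → InBowtie A x → InBowtie A y → _≈ₚ_ A x y → _≈ₚ_ A (δ A x) (δ A y)
  δ-cong (a , b) (a' , b') _ _ (a≈a' , b≈b') = a≈a' , ⇒-cong refl b≈b'

  δ⁻¹-cong : ∀ x y → InSigma A x → InSigma A y → _≈ₚ_ A x y → _≈ₚ_ A (δ⁻¹ A x) (δ⁻¹ A y)
  δ⁻¹-cong (a , b) (a' , b') _ _ (a≈a' , b≈b') = a≈a' , ∧-cong b≈b' (⇒-cong a≈a' refl)

  -- δ turns ⊓ into ⊓ and ⊔ into ⊔ because f ⇒ _ preserves ∨ and ∧.
  δ-∧ : ∀ x y → InBowtie A x → InBowtie A y → _≈ₚ_ A (δ A (_⊓_ A x y)) (_⊓_ A (δ A x) (δ A y))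
  δ-∧ (a , b) (a' , b') _ _ = refl , ⇒-distrib-∨ f b b'

  δ-∨ : ∀ x y → InBowtie A x → InBowtie A y → _≈ₚ_ A (δ A (_⊔ₚ_ A x y)) (_⊔ₚ_ A (δ A x) (δ A y))
  δ-∨ (a , b) (a' , b') _ _ = refl , ⇒-distrib-∧ f b b'

mainTheorem4 : {c ℓ : Level} (A : BRSAlgebra c ℓ) → IsLatticeIsoWithInverse A
mainTheorem4 A = record
  { δ-into   = δ-into
  ; δ-cong   = δ-cong
  ; δ-∧      = δ-∧
  ; δ-∨      = δ-∨
  ; δ⁻¹-into = δ⁻¹-into
  ; δ⁻¹-cong = δ⁻¹-cong
  ; δ⁻¹∘δ    = δ⁻¹∘δ
  ; δ∘δ⁻¹    = δ∘δ⁻¹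
  }
  where open BRSProperties A
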